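{- Let $\langle A,\land_B,\rightarrowtail,0\rangle$ be an algebra of type $(2,2,0)$ satisfying the axioms (B1), (B3), (B4), (B5), (B6), (B7), (B9) and (B10) listed below. Writing $\sim x:=x\rightarrowtail 0$, $1:=0\rightarrowtail 0$ and $x\lor_B y:=((x\rightarrowtail 0)\land_B(y\rightarrowtail 0))\rightarrowtail 0$, the following hold for all $x,y,z\in A$: (a) $\sim 1=0$; (b) $\sim\sim x=x$; (c) $x\rightarrowtail x=1$, and in particular $x\rightarrowtail x=y\rightarrowtail y$; (d) $x=(x\rightarrowtail 0)\rightarrowtail(x\land_B 0)$; (e) $0\land_B 0=0$; (f) $x\land_B y=y\land_B x$; (g) $x\land_B x=x$; (h) $0\land_B 1=0$; (i) $x\land_B 0=0$; (j) $x\lor_B x=x$; (k) $x\lor_B y=y\lor_B x$; (l) $\sim(x\lor_B y)=\sim x\land_B\sim y$ and $\sim(x\land_B y)=\sim x\lor_B\sim y$; (m) $x\land_B(y\lor_B z)=(x\land_B y)\lor_B(x\land_B z)$; (n) $x\lor_B 1=1$.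
   Context: With $\sim_B x:=x\rightarrowtail 0$ and $x\lor_B y:=((x\rightarrowtail 0)\land_B(y\rightarrowtail 0))\rightarrowtail 0$, the axioms are, for all $x,y,z$: (B1) $(x\rightarrowtail x)\rightarrowtail y=y$; (B3) $x\land_B\sim_B(x\land_B\sim_B y)=x\land_B(x\rightarrowtail y)$; (B4) $x\rightarrowtail(y\land_B z)=(x\rightarrowtail y)\land_B(x\rightarrowtail z)$; (B5) $x\rightarrowtail y=\sim_B y\rightarrowtail\sim_B x$; (B6) $x\rightarrowtail(x\rightarrowtail(y\rightarrowtail(y\rightarrowtail z)))=(x\land_B y)\rightarrowtail((x\land_B y)\rightarrowtail z)$; (B7) $\sim_B(\sim_B x\land_B y)\rightarrowtail(x\rightarrowtail y)=x\rightarrowtail y$; (B9) $x\land_B(y\lor_B z)=(z\land_B x)\lor_B(y\land_B x)$; (B10) $(x\land_B\sim_B x)\land_B(y\lor_B\sim_B y)=x\land_B\sim_B x$. -}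

module Defs where

open import Level using (Level; suc)
open import Relation.Binary.PropositionalEquality using (_≡_)
open import Data.Product using (_×_)

record BAlgebra (a : Level) : Set (suc a) where
  infixr 5 _↣_
  infixl 6 _∧B_
  field
    Carrier : Set a
    _∧B_    : Carrier → Carrier → Carrier
    _↣_     : Carrier → Carrier → Carrier
    𝟘       : Carrier

  ∼B_ : Carrier → Carrier
  ∼B x = x ↣ 𝟘

  𝟙 : Carrier
  𝟙 = 𝟘 ↣ 𝟘

  _∨B_ : Carrier → Carrier → Carrier
  x ∨B y = ((x ↣ 𝟘) ∧B (y ↣ 𝟘)) ↣ 𝟘

  field
    B1  : ∀ x y → (x ↣ x) ↣ y ≡ y
    B3  : ∀ x y → x ∧B (∼B (x ∧B (∼B y))) ≡ x ∧B (x ↣ y)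
    B4  : ∀ x y z → x ↣ (y ∧B z) ≡ (x ↣ y) ∧B (x ↣ z)
    B5  : ∀ x y → x ↣ y ≡ (∼B y) ↣ (∼B x)
    B6  : ∀ x y z → x ↣ (x ↣ (y ↣ (y ↣ z))) ≡ (x ∧B y) ↣ ((x ∧B y) ↣ z)
    B7  : ∀ x y → (∼B ((∼B x) ∧B y)) ↣ (x ↣ y) ≡ x ↣ y
    B9  : ∀ x y z → x ∧B (y ∨B z) ≡ (z ∧B x) ∨B (y ∧B x)
    B10 : ∀ x y → (x ∧B (∼B x)) ∧B (y ∨B (∼B y)) ≡ x ∧B (∼B x)

module _ {a : Level} (A : BAlgebra a) where
  open BAlgebra A

  Theorem8Conclusions : Set a
  Theorem8Conclusions =
      (∼B 𝟙 ≡ 𝟘)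
    × (∀ x → ∼B (∼B x) ≡ x)
    × ((∀ x → x ↣ x ≡ 𝟙) × (∀ x y → x ↣ x ≡ y ↣ y))
    × (∀ x → x ≡ (x ↣ 𝟘) ↣ (x ∧B 𝟘))
    × (𝟘 ∧B 𝟘 ≡ 𝟘)
    × (∀ x y → x ∧B y ≡ y ∧B x)
    × (∀ x → x ∧B x ≡ x)
    × (𝟘 ∧B 𝟙 ≡ 𝟘)
    × (∀ x → x ∧B 𝟘 ≡ 𝟘)
    × (∀ x → x ∨B x ≡ x)
    × (∀ x y → x ∨B y ≡ y ∨B x)
    × ((∀ x y → ∼B (x ∨B y) ≡ (∼B x) ∧B (∼B y))
       × (∀ x y → ∼B (x ∧B y) ≡ (∼B x) ∨B (∼B y)))
    × (∀ x y z → x ∧B (y ∨B z) ≡ (x ∧B y) ∨B (x ∧B z))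
    × (∀ x → x ∨B 𝟙 ≡ 𝟙)

{-# OPTIONS --safe #-}
module Submission where

-- Apart from x ∧ 𝟘 = 𝟘 (and (n), which uses it), everything follows quickly from B1, B3, B4,
-- B5, B7 and B9: ∼ is an involution, ↣ contraposes, and ∧ is idempotent and commutative.
-- The substance is that 𝟘 is a bottom. Writing x ↣² z for x ↣ (x ↣ z), B6 gives
-- (x ∧ y) ↣ 𝟙 = x ↣² (y ↣ 𝟙); this first yields 𝟘 ↣ 𝟙 = 𝟙 and then 𝟘 ↣ x = x ↣ 𝟙 = 𝟙 for
-- every x. So 𝟙 is a unit for ∧, and with it B4 shows ∼(x ∧ 𝟘) = 𝟙.

open import Level using (Level)
open import Defs
open import Relation.Binary.PropositionalEquality
  using (_≡_; sym; trans; cong; cong₂; module ≡-Reasoning)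
open import Data.Product using (_,_)

module BAlgebraProperties {a : Level} (A : BAlgebra a) where
  open BAlgebra A
  open ≡-Reasoning

  infixr 5 _↣²_

  _↣²_ : Carrier → Carrier → Carrier
  x ↣² z = x ↣ x ↣ z

  ↣-identityˡ : ∀ y → 𝟙 ↣ y ≡ y
  ↣-identityˡ = B1 𝟘

  ∼𝟙 : ∼B 𝟙 ≡ 𝟘
  ∼𝟙 = B1 𝟘 𝟘

  ∼-involutive : ∀ x → ∼B ∼B x ≡ x
  ∼-involutive x = begin
    ∼B x ↣ 𝟘                 ≡⟨ cong (∼B x ↣_) (sym (B1 x 𝟘)) ⟩
    ∼B x ↣ ∼B (x ↣ x)        ≡⟨ sym (B5 (x ↣ x) x) ⟩
    (x ↣ x) ↣ x              ≡⟨ B1 x x ⟩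
    x                        ∎

  ↣-refl : ∀ x → x ↣ x ≡ 𝟙
  ↣-refl x = trans (sym (∼-involutive (x ↣ x))) (cong (_↣ 𝟘) (B1 x 𝟘))

  ∼↣-swap : ∀ x y → ∼B x ↣ y ≡ ∼B y ↣ x
  ∼↣-swap x y = trans (B5 (∼B x) y) (cong (∼B y ↣_) (∼-involutive x))

  ∼↣𝟙 : ∀ x → ∼B x ↣ 𝟙 ≡ 𝟘 ↣ x
  ∼↣𝟙 x = trans (∼↣-swap x 𝟙) (cong (_↣ x) ∼𝟙)

  ∼↣∧𝟘 : ∀ x → ∼B x ↣ x ∧B 𝟘 ≡ x
  ∼↣∧𝟘 x = begin
    ∼B x ↣ x ∧B 𝟘              ≡⟨ ∼↣-swap x (x ∧B 𝟘) ⟩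
    ∼B (x ∧B 𝟘) ↣ x            ≡⟨ cong (λ w → ∼B (w ∧B 𝟘) ↣ w) (sym (∼-involutive x)) ⟩
    ∼B (∼B ∼B x ∧B 𝟘) ↣ ∼B ∼B x ≡⟨ B7 (∼B x) 𝟘 ⟩
    ∼B ∼B x                    ≡⟨ ∼-involutive x ⟩
    x                          ∎

  𝟘∧𝟘 : 𝟘 ∧B 𝟘 ≡ 𝟘
  𝟘∧𝟘 = trans (sym (↣-identityˡ (𝟘 ∧B 𝟘))) (∼↣∧𝟘 𝟘)

  ∧-idem : ∀ x → x ∧B x ≡ x
  ∧-idem x = begin
    x ∧B x                                ≡⟨ cong₂ _∧B_ (sym (∼-involutive x)) (sym (∼-involutive x)) ⟩
    (∼B x ↣ 𝟘) ∧B (∼B x ↣ 𝟘)              ≡⟨ sym (B4 (∼B x) 𝟘 𝟘) ⟩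
    ∼B x ↣ 𝟘 ∧B 𝟘                         ≡⟨ cong (∼B x ↣_) 𝟘∧𝟘 ⟩
    ∼B ∼B x                               ≡⟨ ∼-involutive x ⟩
    x                                     ∎

  ∨-idem : ∀ x → x ∨B x ≡ x
  ∨-idem x = trans (cong (_↣ 𝟘) (∧-idem (∼B x))) (∼-involutive x)

  ∧-comm : ∀ x y → x ∧B y ≡ y ∧B x
  ∧-comm x y = begin
    x ∧B y                      ≡⟨ cong (x ∧B_) (sym (∨-idem y)) ⟩
    x ∧B (y ∨B y)               ≡⟨ B9 x y y ⟩
    (y ∧B x) ∨B (y ∧B x)        ≡⟨ ∨-idem (y ∧B x) ⟩
    y ∧B x                      ∎

  ∨-comm : ∀ x y → x ∨B y ≡ y ∨B x
  ∨-comm x y = cong (_↣ 𝟘) (∧-comm (∼B x) (∼B y))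

  ∼-∨ : ∀ x y → ∼B (x ∨B y) ≡ ∼B x ∧B ∼B y
  ∼-∨ x y = ∼-involutive (∼B x ∧B ∼B y)

  ∼-∧ : ∀ x y → ∼B (x ∧B y) ≡ (∼B x) ∨B (∼B y)
  ∼-∧ x y = cong ∼B_ (sym (cong₂ _∧B_ (∼-involutive x) (∼-involutive y)))

  ∧-distribˡ-∨ : ∀ x y z → x ∧B (y ∨B z) ≡ (x ∧B y) ∨B (x ∧B z)
  ∧-distribˡ-∨ x y z = begin
    x ∧B (y ∨B z)               ≡⟨ B9 x y z ⟩
    (z ∧B x) ∨B (y ∧B x)        ≡⟨ cong₂ _∨B_ (∧-comm z x) (∧-comm y x) ⟩
    (x ∧B z) ∨B (x ∧B y)        ≡⟨ ∨-comm (x ∧B z) (x ∧B y) ⟩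
    (x ∧B y) ∨B (x ∧B z)        ∎

  -- B3 at x = y = 𝟘 reads 𝟘 ∧ ∼c ≡ c for c = 𝟘 ∧ 𝟙, so ∼c = c ↣ (𝟘 ∧ ∼c) = c ↣ c = 𝟙.
  𝟘∧𝟙 : 𝟘 ∧B 𝟙 ≡ 𝟘
  𝟘∧𝟙 = begin
    c                           ≡⟨ sym (∼-involutive c) ⟩
    ∼B ∼B c                     ≡⟨ cong ∼B_ ∼c≡𝟙 ⟩
    ∼B 𝟙                        ≡⟨ ∼𝟙 ⟩
    𝟘                           ∎
    where
    c : Carrier
    c = 𝟘 ∧B 𝟙

    ∼≡↣𝟘∧∼ : ∀ y → ∼B y ≡ y ↣ 𝟘 ∧B ∼B y
    ∼≡↣𝟘∧∼ y = begin
      ∼B y                      ≡⟨ sym (∼↣∧𝟘 (∼B y)) ⟩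
      ∼B ∼B y ↣ ∼B y ∧B 𝟘       ≡⟨ cong₂ _↣_ (∼-involutive y) (∧-comm (∼B y) 𝟘) ⟩
      y ↣ 𝟘 ∧B ∼B y             ∎

    ∼c≡𝟙 : ∼B c ≡ 𝟙
    ∼c≡𝟙 = trans (∼≡↣𝟘∧∼ c) (trans (cong (c ↣_) (B3 𝟘 𝟘)) (↣-refl c))

  ∧-𝟘↣ : ∀ x → x ∧B (𝟘 ↣ x) ≡ x
  ∧-𝟘↣ x = begin
    x ∧B (𝟘 ↣ x)                ≡⟨ cong₂ _∧B_ (sym (∼-involutive x)) (sym (∼↣𝟙 x)) ⟩
    (∼B x ↣ 𝟘) ∧B (∼B x ↣ 𝟙)    ≡⟨ sym (B4 (∼B x) 𝟘 𝟙) ⟩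
    ∼B x ↣ 𝟘 ∧B 𝟙               ≡⟨ cong (∼B x ↣_) 𝟘∧𝟙 ⟩
    ∼B ∼B x                     ≡⟨ ∼-involutive x ⟩
    x                           ∎

  ↣²-idem : ∀ x z → x ↣² x ↣² z ≡ x ↣² z
  ↣²-idem x z = trans (B6 x x z) (cong (_↣² z) (∧-idem x))

  ↣²-swap : ∀ x y z → x ↣² y ↣² z ≡ y ↣² x ↣² z
  ↣²-swap x y z = trans (B6 x y z) (trans (cong (_↣² z) (∧-comm x y)) (sym (B6 y x z)))

  -- B7 lets one strip the outer ∼(∼x ∧ (x ↣ 𝟙)) = ∼∼x, which by ∧-𝟘↣ is x.
  ↣²𝟙 : ∀ x → x ↣² 𝟙 ≡ x ↣ 𝟙
  ↣²𝟙 x = begin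
    x ↣ x ↣ 𝟙                           ≡⟨ sym (B7 x (x ↣ 𝟙)) ⟩
    ∼B (∼B x ∧B (x ↣ 𝟙)) ↣ x ↣ x ↣ 𝟙    ≡⟨ cong (λ w → ∼B w ↣ x ↣ x ↣ 𝟙) ∼x∧x↣𝟙 ⟩
    ∼B ∼B x ↣ x ↣ x ↣ 𝟙                 ≡⟨ cong (_↣ x ↣ x ↣ 𝟙) (∼-involutive x) ⟩
    x ↣ x ↣ x ↣ 𝟙                       ≡⟨ cong (λ w → x ↣ x ↣ x ↣ w) (sym (↣-refl x)) ⟩
    x ↣² x ↣² x                         ≡⟨ ↣²-idem x x ⟩
    x ↣² x                              ≡⟨ cong (x ↣_) (↣-refl x) ⟩
    x ↣ 𝟙                               ∎
    where
    ∼x∧x↣𝟙 : ∼B x ∧B (x ↣ 𝟙) ≡ ∼B x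
    ∼x∧x↣𝟙 = begin
      ∼B x ∧B (x ↣ 𝟙)                   ≡⟨ cong (λ w → ∼B x ∧B (w ↣ 𝟙)) (sym (∼-involutive x)) ⟩
      ∼B x ∧B (∼B ∼B x ↣ 𝟙)             ≡⟨ cong (∼B x ∧B_) (∼↣𝟙 (∼B x)) ⟩
      ∼B x ∧B (𝟘 ↣ ∼B x)                ≡⟨ ∧-𝟘↣ (∼B x) ⟩
      ∼B x                              ∎

  ∧-↣𝟙 : ∀ x y → x ∧B y ↣ 𝟙 ≡ x ↣² (y ↣ 𝟙)
  ∧-↣𝟙 x y = begin
    x ∧B y ↣ 𝟙                  ≡⟨ sym (↣²𝟙 (x ∧B y)) ⟩
    x ∧B y ↣² 𝟙                 ≡⟨ sym (B6 x y 𝟙) ⟩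
    x ↣² y ↣² 𝟙                 ≡⟨ cong (x ↣²_) (↣²𝟙 y) ⟩
    x ↣² (y ↣ 𝟙)                ∎

  ∧-↣𝟙-cancelʳ : ∀ x {y} → y ↣ 𝟙 ≡ 𝟙 → x ∧B y ↣ 𝟙 ≡ x ↣ 𝟙
  ∧-↣𝟙-cancelʳ x {y} y↣𝟙≡𝟙 = trans (∧-↣𝟙 x y) (trans (cong (x ↣²_) y↣𝟙≡𝟙) (↣²𝟙 x))

  -- For c = 𝟘 ↣ 𝟙, B6 evaluates (𝟘 ∧ c) ↣ 𝟙 to c and (c ∧ 𝟘) ↣ 𝟙 to c ↣ 𝟙 = 𝟙.
  𝟘↣𝟙 : 𝟘 ↣ 𝟙 ≡ 𝟙
  𝟘↣𝟙 = begin
    c                           ≡⟨ sym (↣²𝟙 𝟘) ⟩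
    𝟘 ↣² 𝟙                      ≡⟨ cong (𝟘 ↣²_) (sym c↣𝟙≡𝟙) ⟩
    𝟘 ↣² (c ↣ 𝟙)                ≡⟨ sym (∧-↣𝟙 𝟘 c) ⟩
    𝟘 ∧B c ↣ 𝟙                  ≡⟨ cong (_↣ 𝟙) (∧-comm 𝟘 c) ⟩
    c ∧B 𝟘 ↣ 𝟙                  ≡⟨ ∧-↣𝟙 c 𝟘 ⟩
    c ↣² c                      ≡⟨ cong (c ↣_) (↣-refl c) ⟩
    c ↣ 𝟙                       ≡⟨ c↣𝟙≡𝟙 ⟩
    𝟙                           ∎
    where
    c : Carrier
    c = 𝟘 ↣ 𝟙

    c↣𝟙≡𝟙 : c ↣ 𝟙 ≡ 𝟙
    c↣𝟙≡𝟙 = begin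
      c ↣ 𝟙                     ≡⟨ sym (trans (↣-identityˡ _) (↣-identityˡ _)) ⟩
      𝟙 ↣² (c ↣ 𝟙)              ≡⟨ sym (∧-↣𝟙 𝟙 c) ⟩
      𝟙 ∧B c ↣ 𝟙                ≡⟨ cong (_↣ 𝟙) (∧-𝟘↣ 𝟙) ⟩
      𝟙 ↣ 𝟙                     ≡⟨ ↣-refl 𝟙 ⟩
      𝟙                         ∎

  𝟘↣²-↣𝟙 : ∀ x → 𝟘 ↣² (x ↣ 𝟙) ≡ x ↣ 𝟙
  𝟘↣²-↣𝟙 x = begin
    𝟘 ↣² (x ↣ 𝟙)                ≡⟨ sym (∧-↣𝟙 𝟘 x) ⟩
    𝟘 ∧B x ↣ 𝟙                  ≡⟨ cong (_↣ 𝟙) (∧-comm 𝟘 x) ⟩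
    x ∧B 𝟘 ↣ 𝟙                  ≡⟨ ∧-↣𝟙-cancelʳ x 𝟘↣𝟙 ⟩
    x ↣ 𝟙                       ∎

  𝟘↣-idem : ∀ x → 𝟘 ↣ 𝟘 ↣ x ≡ 𝟘 ↣ x
  𝟘↣-idem x = begin
    t (t x)                     ≡⟨ sym (∧-𝟘↣ (t (t x))) ⟩
    t (t x) ∧B t (t (t x))      ≡⟨ cong (t (t x) ∧B_) t³≡t ⟩
    t (t x) ∧B t x              ≡⟨ ∧-comm (t (t x)) (t x) ⟩
    t x ∧B t (t x)              ≡⟨ ∧-𝟘↣ (t x) ⟩
    t x                         ∎
    where
    t : Carrier → Carrier
    t = 𝟘 ↣_

    t³≡t : t (t (t x)) ≡ t x
    t³≡t = begin
      𝟘 ↣² (𝟘 ↣ x)              ≡⟨ cong (𝟘 ↣²_) (sym (∼↣𝟙 x)) ⟩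
      𝟘 ↣² (∼B x ↣ 𝟙)           ≡⟨ 𝟘↣²-↣𝟙 (∼B x) ⟩
      ∼B x ↣ 𝟙                  ≡⟨ ∼↣𝟙 x ⟩
      𝟘 ↣ x                     ∎

  ↣²-𝟘↣ : ∀ x → x ↣² (𝟘 ↣ x) ≡ x ↣ 𝟙
  ↣²-𝟘↣ x = begin
    x ↣² (𝟘 ↣ x)                ≡⟨ cong (x ↣²_) (sym (𝟘↣-idem x)) ⟩
    x ↣² 𝟘 ↣² x                 ≡⟨ ↣²-swap x 𝟘 x ⟩
    𝟘 ↣² x ↣² x                 ≡⟨ cong (λ w → 𝟘 ↣² (x ↣ w)) (↣-refl x) ⟩
    𝟘 ↣² (x ↣ 𝟙)                ≡⟨ 𝟘↣²-↣𝟙 x ⟩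
    x ↣ 𝟙                       ∎

  ∧∼-↣𝟙 : ∀ x → x ∧B ∼B x ↣ 𝟙 ≡ x ↣ 𝟙
  ∧∼-↣𝟙 x = begin
    x ∧B ∼B x ↣ 𝟙               ≡⟨ ∧-↣𝟙 x (∼B x) ⟩
    x ↣² (∼B x ↣ 𝟙)             ≡⟨ cong (x ↣²_) (∼↣𝟙 x) ⟩
    x ↣² (𝟘 ↣ x)                ≡⟨ ↣²-𝟘↣ x ⟩
    x ↣ 𝟙                       ∎

  𝟘↣≡↣𝟙 : ∀ x → 𝟘 ↣ x ≡ x ↣ 𝟙
  𝟘↣≡↣𝟙 x = begin
    𝟘 ↣ x                       ≡⟨ sym (∼↣𝟙 x) ⟩
    ∼B x ↣ 𝟙                    ≡⟨ sym (∧∼-↣𝟙 (∼B x)) ⟩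
    ∼B x ∧B ∼B ∼B x ↣ 𝟙         ≡⟨ cong (λ w → ∼B x ∧B w ↣ 𝟙) (∼-involutive x) ⟩
    ∼B x ∧B x ↣ 𝟙               ≡⟨ cong (_↣ 𝟙) (∧-comm (∼B x) x) ⟩
    x ∧B ∼B x ↣ 𝟙               ≡⟨ ∧∼-↣𝟙 x ⟩
    x ↣ 𝟙                       ∎

  ↣𝟙-of-𝟙∧ : ∀ {z} → 𝟙 ∧B z ≡ 𝟙 → z ↣ 𝟙 ≡ 𝟙
  ↣𝟙-of-𝟙∧ {z} 𝟙∧z≡𝟙 = begin
    z ↣ 𝟙                       ≡⟨ sym (∧-↣𝟙-cancelʳ z (↣-refl 𝟙)) ⟩
    z ∧B 𝟙 ↣ 𝟙                  ≡⟨ cong (_↣ 𝟙) (trans (∧-comm z 𝟙) 𝟙∧z≡𝟙) ⟩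
    𝟙 ↣ 𝟙                       ≡⟨ ↣-refl 𝟙 ⟩
    𝟙                           ∎

  ↣𝟙-↣𝟙 : ∀ x → (x ↣ 𝟙) ↣ 𝟙 ≡ 𝟙
  ↣𝟙-↣𝟙 x = begin
    (x ↣ 𝟙) ↣ 𝟙                 ≡⟨ cong (_↣ 𝟙) (sym (↣²𝟙 x)) ⟩
    (x ↣ x ↣ 𝟙) ↣ 𝟙             ≡⟨ cong (λ w → (x ↣ w) ↣ 𝟙) (sym (𝟘↣≡↣𝟙 x)) ⟩
    (x ↣ 𝟘 ↣ x) ↣ 𝟙             ≡⟨ ↣𝟙-of-𝟙∧ 𝟙∧x↣𝟘↣x ⟩
    𝟙                           ∎
    where
    𝟙∧x↣𝟘↣x : 𝟙 ∧B (x ↣ 𝟘 ↣ x) ≡ 𝟙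
    𝟙∧x↣𝟘↣x = begin
      𝟙 ∧B (x ↣ 𝟘 ↣ x)          ≡⟨ cong (_∧B (x ↣ 𝟘 ↣ x)) (sym (↣-refl x)) ⟩
      (x ↣ x) ∧B (x ↣ 𝟘 ↣ x)    ≡⟨ sym (B4 x x (𝟘 ↣ x)) ⟩
      x ↣ x ∧B (𝟘 ↣ x)          ≡⟨ cong (x ↣_) (∧-𝟘↣ x) ⟩
      x ↣ x                     ≡⟨ ↣-refl x ⟩
      𝟙                         ∎

  𝟘↣≡𝟙 : ∀ x → 𝟘 ↣ x ≡ 𝟙
  𝟘↣≡𝟙 x = begin
    𝟘 ↣ x                       ≡⟨ sym (𝟘↣-idem x) ⟩
    𝟘 ↣ 𝟘 ↣ x                   ≡⟨ 𝟘↣≡↣𝟙 (𝟘 ↣ x) ⟩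
    (𝟘 ↣ x) ↣ 𝟙                 ≡⟨ cong (_↣ 𝟙) (𝟘↣≡↣𝟙 x) ⟩
    (x ↣ 𝟙) ↣ 𝟙                 ≡⟨ ↣𝟙-↣𝟙 x ⟩
    𝟙                           ∎

  ∧-identityʳ : ∀ x → x ∧B 𝟙 ≡ x
  ∧-identityʳ x = trans (cong (x ∧B_) (sym (𝟘↣≡𝟙 x))) (∧-𝟘↣ x)

  ∧-identityˡ : ∀ x → 𝟙 ∧B x ≡ x
  ∧-identityˡ x = trans (∧-comm 𝟙 x) (∧-identityʳ x)

  -- For c = x ∧ 𝟘 one has ∼c ↣ c = x ∧ c, and y ↣ (∼y ↣ y) = 𝟙 at y = c gives c ↣ x = 𝟙;
  -- hence 𝟙 = c ↣ (x ∧ 𝟘) = (c ↣ x) ∧ ∼c = ∼c.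
  ∧-zeroʳ : ∀ x → x ∧B 𝟘 ≡ 𝟘
  ∧-zeroʳ x = begin
    c                           ≡⟨ sym (∼-involutive c) ⟩
    ∼B ∼B c                     ≡⟨ cong ∼B_ ∼c≡𝟙 ⟩
    ∼B 𝟙                        ≡⟨ ∼𝟙 ⟩
    𝟘                           ∎
    where
    c : Carrier
    c = x ∧B 𝟘

    ↣-∼↣ : ∀ y → y ↣ ∼B y ↣ y ≡ 𝟙
    ↣-∼↣ y = begin
      y ↣ ∼B y ↣ y                        ≡⟨ sym (∧-identityʳ _) ⟩
      (y ↣ ∼B y ↣ y) ∧B 𝟙                 ≡⟨ cong ((y ↣ ∼B y ↣ y) ∧B_) (sym (↣-refl y)) ⟩
      (y ↣ ∼B y ↣ y) ∧B (y ↣ y)           ≡⟨ sym (B4 y (∼B y ↣ y) y) ⟩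
      y ↣ (∼B y ↣ y) ∧B y                 ≡⟨ cong (λ w → y ↣ (∼B y ↣ y) ∧B w) (sym (∼-involutive y)) ⟩
      y ↣ (∼B y ↣ y) ∧B (∼B y ↣ 𝟘)        ≡⟨ cong (y ↣_) (sym (B4 (∼B y) y 𝟘)) ⟩
      y ↣ ∼B y ↣ y ∧B 𝟘                   ≡⟨ cong (y ↣_) (∼↣∧𝟘 y) ⟩
      y ↣ y                               ≡⟨ ↣-refl y ⟩
      𝟙                                   ∎

    ∼c↣c : ∼B c ↣ c ≡ x ∧B c
    ∼c↣c = begin
      ∼B c ↣ x ∧B 𝟘                       ≡⟨ B4 (∼B c) x 𝟘 ⟩
      (∼B c ↣ x) ∧B ∼B ∼B c               ≡⟨ cong₂ _∧B_ (∼↣-swap c x) (∼-involutive c) ⟩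
      (∼B x ↣ c) ∧B c                     ≡⟨ cong (_∧B c) (∼↣∧𝟘 x) ⟩
      x ∧B c                              ∎

    c↣x : c ↣ x ≡ 𝟙
    c↣x = begin
      c ↣ x                               ≡⟨ sym (∧-identityʳ (c ↣ x)) ⟩
      (c ↣ x) ∧B 𝟙                        ≡⟨ cong ((c ↣ x) ∧B_) (sym (↣-refl c)) ⟩
      (c ↣ x) ∧B (c ↣ c)                  ≡⟨ sym (B4 c x c) ⟩
      c ↣ x ∧B c                          ≡⟨ cong (c ↣_) (sym ∼c↣c) ⟩
      c ↣ ∼B c ↣ c                        ≡⟨ ↣-∼↣ c ⟩
      𝟙                                   ∎

    ∼c≡𝟙 : ∼B c ≡ 𝟙
    ∼c≡𝟙 = begin
      ∼B c                                ≡⟨ sym (∧-identityˡ (∼B c)) ⟩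
      𝟙 ∧B ∼B c                           ≡⟨ cong (_∧B ∼B c) (sym c↣x) ⟩
      (c ↣ x) ∧B (c ↣ 𝟘)                  ≡⟨ sym (B4 c x 𝟘) ⟩
      c ↣ c                               ≡⟨ ↣-refl c ⟩
      𝟙                                   ∎

  ∨-zeroʳ : ∀ x → x ∨B 𝟙 ≡ 𝟙
  ∨-zeroʳ x = trans (cong (λ w → ∼B x ∧B w ↣ 𝟘) ∼𝟙) (cong (_↣ 𝟘) (∧-zeroʳ (∼B x)))

mainTheorem8 : ∀ {a : Level} (A : BAlgebra a) → Theorem8Conclusions A
mainTheorem8 A =
    ∼𝟙
  , ∼-involutive
  , (↣-refl , λ x y → trans (↣-refl x) (sym (↣-refl y)))
  , (λ x → sym (∼↣∧𝟘 x))
  , 𝟘∧𝟘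
  , ∧-comm
  , ∧-idem
  , 𝟘∧𝟙
  , ∧-zeroʳ
  , ∨-idem
  , ∨-comm
  , (∼-∨ , ∼-∧)
  , ∧-distribˡ-∨
  , ∨-zeroʳ
  where open BAlgebraProperties A
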